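{- Let $\lambda=(\lambda_1,\dots,\lambda_m)$ be a partition of $n\ge2$, and let $T_{\lambda^{\downarrow}}$ be its column-insertion tableau. For $1\le k\le n$ define $$A^k_{\lambda^{\downarrow}}=\sum_{(i,j):\,n-k<T_{\lambda^{\downarrow}}(i,j)\le n}\big(\lambda_1-(j-i)\big)=k\lambda_1-\sum_{(i,j):\,n-k<T_{\lambda^{\downarrow}}(i,j)\le n}(j-i).$$ Then for every $1\le k\le n$, $$A^k_{\lambda^{\downarrow}}\ge k+\binom{k}{2}\frac{\lambda_1-1}{n-1}.$$
   Context: Rows are indexed top to bottom from 1, columns left to right from 1; $T(i,j)$ is the entry in row $i$, column $j$. The column-insertion tableau $T_{\lambda^{\downarrow}}$ is the standard Young tableau of shape $\lambda$ obtained by writing $1,2,\dots,n$ column by column, top to bottom, starting from the leftmost column. -}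

module Defs where

open import Data.Nat using (ℕ; zero; suc; _+_; _*_; _∸_; _≤_; _<_; _≤?_; _<?_)
open import Data.Nat.Combinatorics using (_C_)
open import Relation.Binary.PropositionalEquality using (_≡_)
open import Data.Nat.ListAction using (sum)
open import Data.Product using (_×_; _,_)
open import Data.List using (List; []; _∷_; map; length; filter; applyUpTo; _++_)
open import Data.List.Relation.Unary.All using (All)
open import Data.List.Relation.Unary.Linked using (Linked)
open import Relation.Nullary.Decidable using (_×-dec_)

record IsPartitionOf (λs : List ℕ) (n : ℕ) : Set where
  field
    positive   : All (λ p → 1 ≤ p) λs
    decreasing : Linked (λ a b → b ≤ a) λs
    sums       : sum λs ≡ n

part₁ : List ℕ → ℕ
part₁ []      = 0
part₁ (p ∷ _) = p

-- length of column j (1-indexed): number of rows r with λ_r ≥ j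
colLen : List ℕ → ℕ → ℕ
colLen λs j = length (filter (j ≤?_) λs)

-- column-insertion tableau: T(i,j) = (λ'₁ + … + λ'_{j-1}) + i
-- (1,…,n written column by column, top to bottom, leftmost column first)
colTab : List ℕ → ℕ → ℕ → ℕ
colTab λs i j = sum (applyUpTo (λ c → colLen λs (suc c)) (j ∸ 1)) + i

-- cells (i,j) of the Young diagram, 1-indexed: 1 ≤ i ≤ m, 1 ≤ j ≤ λ_i
cellsFrom : ℕ → List ℕ → List (ℕ × ℕ)
cellsFrom i []        = []
cellsFrom i (p ∷ ps)  = applyUpTo (λ j → (i , suc j)) p ++ cellsFrom (suc i) ps

cells : List ℕ → List (ℕ × ℕ)
cells λs = cellsFrom 1 λs

-- A^k = Σ over cells (i,j) with n-k < T(i,j) ≤ n of (λ₁ - (j - i)).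
-- On every cell j ≤ λ_i ≤ λ₁, so λ₁ - (j - i) = (λ₁ + i) ∸ j exactly in ℕ.
A : List ℕ → ℕ → ℕ → ℕ
A λs n k =
  sum (map (λ { (i , j) → (part₁ λs + i) ∸ j })
           (filter (λ { (i , j) → ((n ∸ k) <? colTab λs i j) ×-dec (colTab λs i j ≤? n) })
                   (cells λs)))

-- Index the λ₁ columns from 0.  The cell in row i + 1 of column j has value m + 1 + i, where
-- m = λ₁ - 1 - j is the number of columns to its right, and the last k entries of the tableau fill
-- the columns from the right, each column from the bottom.  With F s = (n - 1) s + (λ₁ - 1) C(s,2),
-- induct over the m rightmost columns: if they hold R cells and contribute Q to A, then
-- F (min k R) ≤ (n - 1) Q.  A further column from which q cells are taken contributes at least
-- q (m + 1) + C(q,2), while F grows by (n - 1) q + (λ₁ - 1)(s q + C(q,2)) with s = min k R; the two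
-- compare since λ₁ - 1 ≤ n - 1 and (λ₁ - 1) R ≤ (n - 1) m.  The last inequality holds because the
-- column lengths decrease, so R ≤ m n / λ₁, and n / λ₁ ≤ (n - 1) / (λ₁ - 1).

module Submission where

open import Defs
open import Algebra.Properties.CommutativeSemigroup as CommSemigroupProperties using ()
open import Data.Bool using (true; false; if_then_else_)
open import Data.List using (List; []; _∷_; length; map; filter; applyUpTo; _++_)
open import Data.List.Properties using (map-++; map-applyUpTo; filter-accept; filter-reject; filter-none)
open import Data.List.Relation.Binary.Sublist.Propositional using (⊆-refl)
open import Data.List.Relation.Binary.Sublist.Propositional.Properties using (filter⁺; length-mono-≤)
open import Data.List.Relation.Unary.All as All using (All; []; _∷_)
open import Data.List.Relation.Unary.Linked as Linked using (Linked)
open import Data.List.Relation.Unary.Linked.Properties using (Linked⇒All)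
open import Data.Nat using (ℕ; zero; suc; _+_; _*_; _∸_; _⊓_; _≤_; _<_; _≥_; _≤?_; _<?_; z≤n; s≤s; z<s; s<s)
open import Data.Nat.Combinatorics using (_C_; nC1≡n; nCk+nC[k+1]≡[n+1]C[k+1])
open import Data.Nat.ListAction using (sum)
open import Data.Nat.ListAction.Properties using (sum-++)
open import Data.Nat.Properties
open import Data.Nat.Tactic.RingSolver using (solve-∀)
open import Data.Product using (_×_; _,_)
open import Data.Sum using (inj₁; inj₂)
open import Function using (_∘_)
open import Relation.Binary.PropositionalEquality
open import Relation.Nullary using (Dec; does; yes; no; ¬_)
open import Relation.Nullary.Decidable using (dec-true; dec-false; _×-dec_)
open import Relation.Unary using (Pred; Decidable)

private
  module +-CS = CommSemigroupProperties +-commutativeSemigroup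
  module *-CS = CommSemigroupProperties *-commutativeSemigroup

∑ : ℕ → (ℕ → ℕ) → ℕ
∑ n f = sum (applyUpTo f n)

syntax ∑ n (λ i → e) = ∑[ i < n ] e

∑-cong : ∀ n {f g : ℕ → ℕ} → (∀ i → i < n → f i ≡ g i) → ∑ n f ≡ ∑ n g
∑-cong zero    f≗g = refl
∑-cong (suc n) f≗g = cong₂ _+_ (f≗g 0 z<s) (∑-cong n (λ i i<n → f≗g (suc i) (s<s i<n)))

∑-mono-≤ : ∀ n {f g : ℕ → ℕ} → (∀ i → i < n → f i ≤ g i) → ∑ n f ≤ ∑ n g
∑-mono-≤ zero    f≤g = z≤n
∑-mono-≤ (suc n) f≤g = +-mono-≤ (f≤g 0 z<s) (∑-mono-≤ n (λ i i<n → f≤g (suc i) (s<s i<n)))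

∑-+ : ∀ n (f g : ℕ → ℕ) → ∑[ i < n ] (f i + g i) ≡ ∑ n f + ∑ n g
∑-+ zero    f g = refl
∑-+ (suc n) f g = begin
    f 0 + g 0 + ∑[ i < n ] (f (suc i) + g (suc i))
      ≡⟨ cong (f 0 + g 0 +_) (∑-+ n (f ∘ suc) (g ∘ suc)) ⟩
    f 0 + g 0 + (∑ n (f ∘ suc) + ∑ n (g ∘ suc))
      ≡⟨ +-CS.interchange (f 0) (g 0) _ _ ⟩
    f 0 + ∑ n (f ∘ suc) + (g 0 + ∑ n (g ∘ suc)) ∎
  where open ≡-Reasoning

∑-const : ∀ n c → ∑[ _ < n ] c ≡ n * c
∑-const zero    c = refl
∑-const (suc n) c = cong (c +_) (∑-const n c)

∑-split : ∀ a b (f : ℕ → ℕ) → ∑ (a + b) f ≡ ∑ a f + ∑[ i < b ] f (a + i)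
∑-split zero    b f = refl
∑-split (suc a) b f = trans (cong (f 0 +_) (∑-split a b (f ∘ suc))) (sym (+-assoc (f 0) _ _))

∑-offset-suc : ∀ (f : ℕ → ℕ) j m → ∑[ u < suc m ] f (j + u) ≡ f j + ∑[ u < m ] f (suc j + u)
∑-offset-suc f j m =
  cong₂ _+_ (cong f (+-identityʳ j)) (∑-cong m (λ u _ → cong f (+-suc j u)))

∑-id : ∀ n → ∑[ i < n ] i ≡ n C 2
∑-id zero    = refl
∑-id (suc n) = begin
    ∑[ i < n ] (1 + i)           ≡⟨ ∑-+ n (λ _ → 1) (λ i → i) ⟩
    ∑[ _ < n ] 1 + ∑[ i < n ] i  ≡⟨ cong₂ _+_ (trans (∑-const n 1) (*-identityʳ n)) (∑-id n) ⟩
    n + n C 2                    ≡⟨ cong (_+ n C 2) (sym (nC1≡n n)) ⟩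
    n C 1 + n C 2                ≡⟨ nCk+nC[k+1]≡[n+1]C[k+1] n 1 ⟩
    suc n C 2 ∎
  where open ≡-Reasoning

∑-arithmetic : ∀ b q → ∑[ i < q ] (b + i) ≡ q * b + q C 2
∑-arithmetic b q = trans (∑-+ q (λ _ → b) (λ i → i)) (cong₂ _+_ (∑-const q b) (∑-id q))

[m+n]C2≡mC2+m*n+nC2 : ∀ m n → (m + n) C 2 ≡ m C 2 + m * n + n C 2
[m+n]C2≡mC2+m*n+nC2 m n = begin
    (m + n) C 2                          ≡⟨ sym (∑-id (m + n)) ⟩
    ∑[ i < m + n ] i                     ≡⟨ ∑-split m n (λ i → i) ⟩
    ∑[ i < m ] i + ∑[ i < n ] (m + i)    ≡⟨ cong₂ _+_ (∑-id m) (∑-arithmetic m n) ⟩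
    m C 2 + (n * m + n C 2)              ≡⟨ cong (λ x → m C 2 + (x + n C 2)) (*-comm n m) ⟩
    m C 2 + (m * n + n C 2)              ≡⟨ sym (+-assoc (m C 2) _ _) ⟩
    m C 2 + m * n + n C 2 ∎
  where open ≡-Reasoning

∑-restrict : ∀ (f : ℕ → ℕ) {p M} → p ≤ M →
  ∑[ j < M ] (if does (suc j ≤? p) then f j else 0) ≡ ∑ p f
∑-restrict f {zero}  {M}     _         = trans (∑-const M 0) (*-zeroʳ M)
∑-restrict f {suc p} {suc M} (s≤s p≤M) = cong (f 0 +_) (∑-restrict (f ∘ suc) p≤M)

∑-tail-average : ∀ {f : ℕ → ℕ} → (∀ {a b} → a ≤ b → f b ≤ f a) → ∀ j m →
  (j + m) * ∑[ u < m ] f (j + u) ≤ m * ∑ (j + m) f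
∑-tail-average {f} antitone j m = begin
    (j + m) * R            ≡⟨ *-distribʳ-+ R j m ⟩
    j * R + m * R          ≤⟨ +-monoˡ-≤ (m * R) (*-monoʳ-≤ j R≤m*fj) ⟩
    j * (m * f j) + m * R  ≡⟨ cong (_+ m * R) (*-CS.x∙yz≈y∙xz j m (f j)) ⟩
    m * (j * f j) + m * R  ≤⟨ +-monoˡ-≤ (m * R) (*-monoʳ-≤ m j*fj≤P) ⟩
    m * ∑ j f + m * R      ≡⟨ sym (*-distribˡ-+ m (∑ j f) R) ⟩
    m * (∑ j f + R)        ≡⟨ cong (m *_) (sym (∑-split j m f)) ⟩
    m * ∑ (j + m) f ∎
  where
    open ≤-Reasoning
    R : ℕ
    R = ∑[ u < m ] f (j + u)
    R≤m*fj : R ≤ m * f j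
    R≤m*fj = ≤-trans (∑-mono-≤ m (λ u _ → antitone (m≤m+n j u))) (≤-reflexive (∑-const m (f j)))
    j*fj≤P : j * f j ≤ ∑ j f
    j*fj≤P = ≤-trans (≤-reflexive (sym (∑-const j (f j)))) (∑-mono-≤ j (λ u u<j → antitone (<⇒≤ u<j)))

[m∸1]*n≤m*[n∸1] : ∀ {m n} → m ≤ n → (m ∸ 1) * n ≤ m * (n ∸ 1)
[m∸1]*n≤m*[n∸1] {zero}          _         = z≤n
[m∸1]*n≤m*[n∸1] {suc m} {suc n} (s≤s m≤n) = begin
    m * suc n  ≡⟨ *-suc m n ⟩
    m + m * n  ≤⟨ +-monoˡ-≤ (m * n) m≤n ⟩
    n + m * n  ∎
  where open ≤-Reasoning

-- r / m ≤ n / L ≤ (n - 1) / (L - 1)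
ratio-bound-pred : ∀ {L n r m} → L ≤ n → L * r ≤ m * n → (L ∸ 1) * r ≤ (n ∸ 1) * m
ratio-bound-pred {zero} _ _ = z≤n
ratio-bound-pred {suc L} {n} {r} {m} L≤n L*r≤m*n = *-cancelˡ-≤ (suc L) (begin
    suc L * (L * r)        ≡⟨ *-CS.x∙yz≈y∙xz (suc L) L r ⟩
    L * (suc L * r)        ≤⟨ *-monoʳ-≤ L L*r≤m*n ⟩
    L * (m * n)            ≡⟨ *-CS.x∙yz≈y∙xz L m n ⟩
    m * (L * n)            ≤⟨ *-monoʳ-≤ m ([m∸1]*n≤m*[n∸1] L≤n) ⟩
    m * (suc L * (n ∸ 1))  ≡⟨ *-CS.x∙yz≈y∙xz m (suc L) (n ∸ 1) ⟩
    suc L * (m * (n ∸ 1))  ≡⟨ cong (suc L *_) (*-comm m (n ∸ 1)) ⟩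
    suc L * ((n ∸ 1) * m)  ∎)
  where open ≤-Reasoning

quadratic-step : ∀ {N D s q m Q col} → D ≤ N → D * s ≤ N * m →
  N * s + D * (s C 2) ≤ N * Q → q * suc m + q C 2 ≤ col →
  N * (s + q) + D * ((s + q) C 2) ≤ N * (col + Q)
quadratic-step {N} {D} {s} {q} {m} {Q} {col} D≤N D*s≤N*m IH col≥ = begin
    N * (s + q) + D * ((s + q) C 2)
      ≡⟨ cong (λ x → N * (s + q) + D * x) ([m+n]C2≡mC2+m*n+nC2 s q) ⟩
    N * (s + q) + D * (s C 2 + s * q + q C 2)
      ≡⟨ expand N D s q (s C 2) (q C 2) ⟩
    (N * s + D * (s C 2)) + (N * q + (D * s) * q + D * (q C 2))
      ≤⟨ +-mono-≤ IH (+-mono-≤ (+-monoʳ-≤ (N * q) (*-monoˡ-≤ q D*s≤N*m)) (*-monoˡ-≤ (q C 2) D≤N)) ⟩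
    N * Q + (N * q + (N * m) * q + N * (q C 2))
      ≡⟨ cong (N * Q +_) (collect N q m (q C 2)) ⟩
    N * Q + N * (q * suc m + q C 2)
      ≤⟨ +-monoʳ-≤ (N * Q) (*-monoʳ-≤ N col≥) ⟩
    N * Q + N * col
      ≡⟨ trans (+-comm (N * Q) (N * col)) (sym (*-distribˡ-+ N col Q)) ⟩
    N * (col + Q) ∎
  where
    open ≤-Reasoning
    expand : ∀ N D s q X Y →
      N * (s + q) + D * (X + s * q + Y) ≡ (N * s + D * X) + (N * q + (D * s) * q + D * Y)
    expand = solve-∀
    collect : ∀ N q m Y → N * q + (N * m) * q + N * Y ≡ N * (q * suc m + Y)
    collect = solve-∀

m⊓[o+n]≡m⊓n+[m∸n]⊓o : ∀ m n o → m ⊓ (o + n) ≡ m ⊓ n + (m ∸ n) ⊓ o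
m⊓[o+n]≡m⊓n+[m∸n]⊓o m n o with ≤-total n m
... | inj₁ n≤m = begin
    m ⊓ (o + n)             ≡⟨ cong₂ _⊓_ (sym (m+[n∸m]≡n n≤m)) (+-comm o n) ⟩
    (n + (m ∸ n)) ⊓ (n + o) ≡⟨ sym (+-distribˡ-⊓ n (m ∸ n) o) ⟩
    n + (m ∸ n) ⊓ o         ≡⟨ cong (_+ (m ∸ n) ⊓ o) (sym (m≥n⇒m⊓n≡n n≤m)) ⟩
    m ⊓ n + (m ∸ n) ⊓ o     ∎
  where open ≡-Reasoning
... | inj₂ m≤n = begin
    m ⊓ (o + n)             ≡⟨ m≤n⇒m⊓n≡m (≤-trans m≤n (m≤n+m n o)) ⟩
    m                       ≡⟨ sym (+-identityʳ m) ⟩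
    m + 0 ⊓ o               ≡⟨ cong₂ (λ x y → x + y ⊓ o) (sym (m≤n⇒m⊓n≡m m≤n)) (sym (m≤n⇒m∸n≡0 m≤n)) ⟩
    m ⊓ n + (m ∸ n) ⊓ o     ∎
  where open ≡-Reasoning

sum-map-filter : ∀ {a p} {X : Set a} {P : Pred X p} (P? : Decidable P) (h : X → ℕ) xs →
  sum (map h (filter P? xs)) ≡ sum (map (λ x → if does (P? x) then h x else 0) xs)
sum-map-filter P? h []       = refl
sum-map-filter P? h (x ∷ xs) with does (P? x)
... | true  = cong (h x +_) (sum-map-filter P? h xs)
... | false = sum-map-filter P? h xs

if-does-yes : ∀ {p} {P : Set p} (P? : Dec P) → P → {x : ℕ} → (if does P? then x else 0) ≡ x
if-does-yes P? p rewrite dec-true P? p = refl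

if-does-no : ∀ {p} {P : Set p} (P? : Dec P) → ¬ P → {x : ℕ} → (if does P? then x else 0) ≡ 0
if-does-no P? ¬p rewrite dec-false P? ¬p = refl

part₁≤sum : ∀ xs → part₁ xs ≤ sum xs
part₁≤sum []       = z≤n
part₁≤sum (p ∷ ps) = m≤m+n p (sum ps)

All-≤-part₁ : ∀ {xs} → Linked _≥_ xs → All (_≤ part₁ xs) xs
All-≤-part₁ {[]}    _  = []
All-≤-part₁ {_ ∷ _} lk = Linked⇒All (λ y≤x z≤y → ≤-trans z≤y y≤x) ≤-refl lk

sum-map-cellsFrom-∷ : ∀ (g : ℕ × ℕ → ℕ) i p ps →
  sum (map g (cellsFrom i (p ∷ ps))) ≡ ∑[ j < p ] g (i , suc j) + sum (map g (cellsFrom (suc i) ps))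
sum-map-cellsFrom-∷ g i p ps = begin
    sum (map g (row ++ rest))          ≡⟨ cong sum (map-++ g row rest) ⟩
    sum (map g row ++ map g rest)      ≡⟨ sum-++ (map g row) _ ⟩
    sum (map g row) + sum (map g rest) ≡⟨ cong (_+ _) (cong sum (map-applyUpTo _ g p)) ⟩
    ∑[ j < p ] g (i , suc j) + sum (map g (cellsFrom (suc i) ps)) ∎
  where
    open ≡-Reasoning
    row rest : List (ℕ × ℕ)
    row = applyUpTo (λ j → (i , suc j)) p
    rest = cellsFrom (suc i) ps

count-cellsFrom : ∀ i λs → sum (map (λ _ → 1) (cellsFrom i λs)) ≡ sum λs
count-cellsFrom i []       = refl
count-cellsFrom i (p ∷ ps) = begin
    sum (map (λ _ → 1) (cellsFrom i (p ∷ ps)))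
      ≡⟨ sum-map-cellsFrom-∷ _ i p ps ⟩
    ∑[ _ < p ] 1 + sum (map (λ _ → 1) (cellsFrom (suc i) ps))
      ≡⟨ cong₂ _+_ (trans (∑-const p 1) (*-identityʳ p)) (count-cellsFrom (suc i) ps) ⟩
    p + sum ps ∎
  where open ≡-Reasoning

colLen-antitone : ∀ λs {a b} → a ≤ b → colLen λs b ≤ colLen λs a
colLen-antitone λs {a} {b} a≤b =
  length-mono-≤ (filter⁺ (b ≤?_) (a ≤?_) (λ { refl b≤x → ≤-trans a≤b b≤x }) (⊆-refl {x = λs}))

∑-column-∷ : ∀ (g : ℕ × ℕ → ℕ) i p ps j → All (_≤ p) ps →
  ∑[ r < colLen (p ∷ ps) (suc j) ] g (i + r , suc j)
    ≡ (if does (suc j ≤? p) then g (i , suc j) else 0) + ∑[ r < colLen ps (suc j) ] g (suc i + r , suc j)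
∑-column-∷ g i p ps j ps≤p with suc j ≤? p
... | yes j<p = begin
    ∑ (colLen (p ∷ ps) (suc j)) G
      ≡⟨ cong (λ l → ∑ l G) (cong length (filter-accept (suc j ≤?_) j<p)) ⟩
    ∑ (suc (colLen ps (suc j))) G
      ≡⟨ ∑-offset-suc (λ r → g (r , suc j)) i (colLen ps (suc j)) ⟩
    g (i , suc j) + lower
      ≡⟨ cong (_+ lower) (sym (if-does-yes (suc j ≤? p) j<p)) ⟩
    (if does (suc j ≤? p) then g (i , suc j) else 0) + lower ∎
  where
    open ≡-Reasoning
    G : ℕ → ℕ
    G r = g (i + r , suc j)
    lower : ℕ
    lower = ∑[ r < colLen ps (suc j) ] g (suc i + r , suc j)
... | no j≮p = begin
    ∑ (colLen (p ∷ ps) (suc j)) G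
      ≡⟨ cong (λ l → ∑ l G) (trans (cong length (filter-reject (suc j ≤?_) j≮p)) lower-empty) ⟩
    0
      ≡⟨ cong₂ _+_ (sym (if-does-no (suc j ≤? p) j≮p)) (cong (λ l → ∑ l G′) (sym lower-empty)) ⟩
    (if does (suc j ≤? p) then g (i , suc j) else 0) + ∑ (colLen ps (suc j)) G′ ∎
  where
    open ≡-Reasoning
    G G′ : ℕ → ℕ
    G  r = g (i + r , suc j)
    G′ r = g (suc i + r , suc j)
    lower-empty : colLen ps (suc j) ≡ 0
    lower-empty =
      cong length (filter-none (suc j ≤?_) (All.map (λ x≤p j<x → j≮p (≤-trans j<x x≤p)) ps≤p))

sum-map-cellsFrom-by-columns : ∀ (g : ℕ × ℕ → ℕ) i λs {M} → All (_≤ M) λs → Linked _≥_ λs →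
  sum (map g (cellsFrom i λs)) ≡ ∑[ j < M ] ∑[ r < colLen λs (suc j) ] g (i + r , suc j)
sum-map-cellsFrom-by-columns g i []       {M} _          _  = sym (trans (∑-const M 0) (*-zeroʳ M))
sum-map-cellsFrom-by-columns g i (p ∷ ps) {M} (p≤M ∷ ps≤M) lk = begin
    sum (map g (cellsFrom i (p ∷ ps)))
      ≡⟨ sum-map-cellsFrom-∷ g i p ps ⟩
    ∑[ j < p ] g (i , suc j) + sum (map g (cellsFrom (suc i) ps))
      ≡⟨ cong₂ _+_ (sym (∑-restrict (λ j → g (i , suc j)) p≤M))
                   (sum-map-cellsFrom-by-columns g (suc i) ps ps≤M (Linked.tail lk)) ⟩
    ∑[ j < M ] (if does (suc j ≤? p) then g (i , suc j) else 0) + ∑[ j < M ] lower j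
      ≡⟨ sym (∑-+ M _ lower) ⟩
    ∑[ j < M ] ((if does (suc j ≤? p) then g (i , suc j) else 0) + lower j)
      ≡⟨ ∑-cong M (λ j _ → sym (∑-column-∷ g i p ps j (All.tail (All-≤-part₁ lk)))) ⟩
    ∑[ j < M ] ∑[ r < colLen (p ∷ ps) (suc j) ] g (i + r , suc j) ∎
  where
    open ≡-Reasoning
    lower : ℕ → ℕ
    lower j = ∑[ r < colLen ps (suc j) ] g (suc i + r , suc j)

module ColumnInduction (λs : List ℕ) (n k : ℕ) (isP : IsPartitionOf λs n) where
  open IsPartitionOf isP

  L N D : ℕ
  L = part₁ λs
  N = n ∸ 1
  D = L ∸ 1

  c : ℕ → ℕ
  c j = colLen λs (suc j)

  R : ℕ → ℕ → ℕ
  R j m = ∑[ u < m ] c (j + u)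

  weight : ℕ × ℕ → ℕ
  weight (i , j) =
    if does (((n ∸ k) <? colTab λs i j) ×-dec (colTab λs i j ≤? n)) then (L + i) ∸ j else 0

  col : ℕ → ℕ
  col j = ∑[ i < c j ] weight (suc i , suc j)

  Q : ℕ → ℕ → ℕ
  Q j m = ∑[ u < m ] col (j + u)

  -- the last k entries fill the m columns after column j first, then column j from the bottom
  taken : ℕ → ℕ → ℕ
  taken j m = (k ∸ R (suc j) m) ⊓ c j

  F : ℕ → ℕ
  F s = N * s + D * (s C 2)

  parts≤L : All (_≤ L) λs
  parts≤L = All-≤-part₁ decreasing

  A≡Q : A λs n k ≡ Q 0 L
  A≡Q = trans (sum-map-filter _ _ (cells λs)) (sum-map-cellsFrom-by-columns _ 1 λs parts≤L decreasing)

  ∑c≡n : ∑ L c ≡ n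
  ∑c≡n = begin
      ∑ L c                           ≡⟨ ∑-cong L (λ j _ → sym (trans (∑-const (c j) 1) (*-identityʳ (c j)))) ⟩
      ∑[ j < L ] ∑[ _ < c j ] 1       ≡⟨ sym (sum-map-cellsFrom-by-columns _ 1 λs parts≤L decreasing) ⟩
      sum (map (λ _ → 1) (cells λs))  ≡⟨ count-cellsFrom 1 λs ⟩
      sum λs                          ≡⟨ sums ⟩
      n ∎
    where open ≡-Reasoning

  L≤n : L ≤ n
  L≤n = subst (L ≤_) sums (part₁≤sum λs)

  D≤N : D ≤ N
  D≤N = ∸-monoˡ-≤ 1 L≤n

  ∑c+R≡n : ∀ j m → j + m ≡ L → ∑ j c + R j m ≡ n
  ∑c+R≡n j m eq = trans (sym (∑-split j m c)) (trans (cong (λ t → ∑ t c) eq) ∑c≡n)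

  D*R≤N*m : ∀ j m → j + m ≡ L → D * R j m ≤ N * m
  D*R≤N*m j m eq = ratio-bound-pred L≤n (begin
      L * R j m             ≡⟨ cong (_* R j m) (sym eq) ⟩
      (j + m) * R j m       ≤⟨ ∑-tail-average (λ a≤b → colLen-antitone λs (s≤s a≤b)) j m ⟩
      m * ∑ (j + m) c       ≡⟨ cong (m *_) (trans (∑-split j m c) (∑c+R≡n j m eq)) ⟩
      m * n ∎)
    where open ≤-Reasoning

  cell-value : ∀ j m i → j + suc m ≡ L → (L + suc i) ∸ suc j ≡ suc m + i
  cell-value j m i eq = begin
      (L + suc i) ∸ suc j          ≡⟨ cong (λ t → (t + suc i) ∸ suc j) (sym eq) ⟩
      (j + suc m + suc i) ∸ suc j  ≡⟨ cong (_∸ suc j) (+-suc (j + suc m) i) ⟩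
      (j + suc m + i) ∸ j          ≡⟨ cong (_∸ j) (+-assoc j (suc m) i) ⟩
      (j + (suc m + i)) ∸ j        ≡⟨ m+n∸m≡n j (suc m + i) ⟩
      suc m + i ∎
    where open ≡-Reasoning

  column-bound : ∀ j m → j + suc m ≡ L → taken j m * suc m + taken j m C 2 ≤ col j
  column-bound j m eq = begin
      q * suc m + q C 2             ≡⟨ sym (∑-arithmetic (suc m) q) ⟩
      ∑[ u < q ] (suc m + u)        ≤⟨ ∑-mono-≤ q (λ u u<q → ≤-trans (+-monoʳ-≤ (suc m) (m≤n+m u a))
                                                                    (≤-reflexive (sym (weight-taken u u<q)))) ⟩
      ∑[ u < q ] f (a + u)          ≤⟨ m≤n+m _ (∑ a f) ⟩
      ∑ a f + ∑[ u < q ] f (a + u)  ≡⟨ sym (∑-split a q f) ⟩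
      ∑ (a + q) f                   ≡⟨ cong (λ t → ∑ t f) a+q≡cj ⟩
      col j ∎
    where
      open ≤-Reasoning
      R′ q a P : ℕ
      R′ = R (suc j) m
      q = taken j m
      a = c j ∸ q
      P = ∑ j c
      f : ℕ → ℕ
      f i = weight (suc i , suc j)
      a+q≡cj : a + q ≡ c j
      a+q≡cj = m∸n+n≡m (m⊓n≤n (k ∸ R′) (c j))
      n≡P+cj+R′ : n ≡ P + (c j + R′)
      n≡P+cj+R′ = sym (trans (cong (P +_) (sym (∑-offset-suc c j m))) (∑c+R≡n j (suc m) eq))
      weight-taken : ∀ u → u < q → f (a + u) ≡ suc m + (a + u)
      weight-taken u u<q =
        trans (if-does-yes ((n ∸ k <? P + suc (a + u)) ×-dec (P + suc (a + u) ≤? n))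
                           (after-n∸k , within-n))
              (cell-value j m (a + u) eq)
        where
          R′<k : R′ < k
          R′<k = m∸n≢0⇒n<m (>⇒≢ (<-≤-trans (≤-<-trans z≤n u<q) (m⊓n≤m (k ∸ R′) (c j))))
          q+R′≤k : q + R′ ≤ k
          q+R′≤k = m≤o∸n⇒m+n≤o q (<⇒≤ R′<k) (m⊓n≤m (k ∸ R′) (c j))
          n≤k+P+a+u : n ≤ k + (P + (a + u))
          n≤k+P+a+u = begin
              n                   ≡⟨ n≡P+cj+R′ ⟩
              P + (c j + R′)      ≡⟨ cong (λ t → P + (t + R′)) (sym a+q≡cj) ⟩
              P + (a + q + R′)    ≡⟨ cong (P +_) (+-assoc a q R′) ⟩
              P + (a + (q + R′))  ≤⟨ +-monoʳ-≤ P (+-monoʳ-≤ a q+R′≤k) ⟩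
              P + (a + k)         ≡⟨ +-CS.x∙yz≈z∙xy P a k ⟩
              k + (P + a)         ≤⟨ +-monoʳ-≤ k (+-monoʳ-≤ P (m≤m+n a u)) ⟩
              k + (P + (a + u))   ∎
          after-n∸k : n ∸ k < P + suc (a + u)
          after-n∸k = ≤-<-trans (m≤n+o⇒m∸n≤o n k n≤k+P+a+u) (+-monoʳ-< P (n<1+n (a + u)))
          within-n : P + suc (a + u) ≤ n
          within-n = begin
              P + suc (a + u)     ≡⟨ cong (P +_) (sym (+-suc a u)) ⟩
              P + (a + suc u)     ≤⟨ +-monoʳ-≤ P (+-monoʳ-≤ a u<q) ⟩
              P + (a + q)         ≡⟨ cong (P +_) a+q≡cj ⟩
              P + c j             ≤⟨ +-monoʳ-≤ P (m≤m+n (c j) R′) ⟩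
              P + (c j + R′)      ≡⟨ sym n≡P+cj+R′ ⟩
              n ∎

  F[k⊓R]≤N*Q : ∀ m j → j + m ≡ L → F (k ⊓ R j m) ≤ N * Q j m
  F[k⊓R]≤N*Q zero    j _ rewrite ⊓-zeroʳ k | *-zeroʳ N | *-zeroʳ D = z≤n
  F[k⊓R]≤N*Q (suc m) j eq = begin
      F (k ⊓ R j (suc m))              ≡⟨ cong F (trans (cong (k ⊓_) (∑-offset-suc c j m))
                                                        (m⊓[o+n]≡m⊓n+[m∸n]⊓o k (R (suc j) m) (c j))) ⟩
      F (k ⊓ R (suc j) m + taken j m)  ≤⟨ quadratic-step D≤N D*s≤N*m (F[k⊓R]≤N*Q m (suc j) eq′)
                                                         (column-bound j m eq) ⟩
      N * (col j + Q (suc j) m)        ≡⟨ cong (N *_) (sym (∑-offset-suc col j m)) ⟩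
      N * Q j (suc m) ∎
    where
      open ≤-Reasoning
      eq′ : suc j + m ≡ L
      eq′ = trans (sym (+-suc j m)) eq
      D*s≤N*m : D * (k ⊓ R (suc j) m) ≤ N * m
      D*s≤N*m = ≤-trans (*-monoʳ-≤ D (m⊓n≤n k _)) (D*R≤N*m (suc j) m eq′)

lemma4p2 : (n : ℕ) → 2 ≤ n → (λs : List ℕ) → IsPartitionOf λs n →
    (k : ℕ) → 1 ≤ k → k ≤ n →
    (n ∸ 1) * k + (k C 2) * (part₁ λs ∸ 1) ≤ (n ∸ 1) * A λs n k
lemma4p2 n _ λs isP k _ k≤n = begin
    N * k + (k C 2) * D  ≡⟨ cong (N * k +_) (*-comm (k C 2) D) ⟩
    F k                  ≡⟨ cong F (sym (m≤n⇒m⊓n≡m (subst (k ≤_) (sym ∑c≡n) k≤n))) ⟩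
    F (k ⊓ R 0 L)        ≤⟨ F[k⊓R]≤N*Q L 0 refl ⟩
    N * Q 0 L            ≡⟨ cong (N *_) (sym A≡Q) ⟩
    N * A λs n k         ∎
  where
    open ColumnInduction λs n k isP
    open ≤-Reasoning
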